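{- Let $m\geqslant 3$ and let $R(m,3)$ be the rectangular supergrid graph defined below. Let $z_1=(m,1)$, $z_2=(m,2)$, $z_3=(m,3)$, and let $s,t$ be two distinct vertices of $R(m,3)$ with $\{s,t\}\cap\{z_1,z_2,z_3\}=\emptyset$. Then there exists a Hamiltonian path of $R(m,3)$ from $s$ to $t$ that contains both edges $(z_1,z_2)$ and $(z_2,z_3)$.
   Context: The supergrid graph on a finite set $V\subset\mathbb{Z}^2$ is the graph with vertex set $V$ in which two distinct vertices $u=(u_x,u_y)$ and $v=(v_x,v_y)$ are adjacent iff $|u_x-v_x|\leqslant 1$ and $|u_y-v_y|\leqslant 1$. The rectangular supergrid graph $R(m,n)$ is the supergrid graph on $\{(x,y): 1\leqslant x\leqslant m,\ 1\leqslant y\leqslant n\}$. A Hamiltonian path from $s$ to $t$ is a simple path with endpoints $s$ and $t$ visiting every vertex exactly once. -}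

module Defs where

open import Data.Nat using (ℕ; _≤_; ∣_-_∣)
open import Data.Product using (_×_; _,_; proj₁; proj₂; ∃)
open import Data.List using (List; []; _∷_; head; last)
open import Data.Maybe using (just)
open import Data.List.Membership.Propositional using (_∈_)
open import Data.List.Relation.Unary.All using (All)
open import Data.List.Relation.Unary.Unique.Propositional using (Unique)
open import Data.List.Relation.Unary.Linked using (Linked)
open import Relation.Binary.PropositionalEquality using (_≡_)
open import Relation.Nullary using (¬_)
open import Data.Sum using (_⊎_)

-- Points of ℤ² restricted to positive coordinates (rectangular grids live there).
Point : Set
Point = ℕ × ℕ

InRect : ℕ → ℕ → Point → Set
InRect m n (x , y) = (1 ≤ x × x ≤ m) × (1 ≤ y × y ≤ n)

SAdj : Point → Point → Set
SAdj (ux , uy) (vx , vy) =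
  ¬ ((ux , uy) ≡ (vx , vy)) × (∣ ux - vx ∣ ≤ 1 × ∣ uy - vy ∣ ≤ 1)

record IsHamPath (m n : ℕ) (s t : Point) (P : List Point) : Set where
  field
    inside    : All (InRect m n) P
    covers    : ∀ v → InRect m n v → v ∈ P
    distinct  : Unique P
    adjacent  : Linked SAdj P
    startsAt  : head P ≡ just s
    endsAt    : last P ≡ just t

data HasEdge (u v : Point) : List Point → Set where
  here-uv : ∀ {xs} → HasEdge u v (u ∷ v ∷ xs)
  here-vu : ∀ {xs} → HasEdge u v (v ∷ u ∷ xs)
  there   : ∀ {x xs} → HasEdge u v xs → HasEdge u v (x ∷ xs)

module Submission where

-- Call a Hamiltonian path of R(M,3) extendable if it uses both vertical edges of column M and
-- some vertical edge of column 1.  A vertical edge of column c can be replaced by a detour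
-- through an empty neighbouring column c′ that runs along all of c′, so the detour contains both
-- vertical edges of c′.  Detouring off column M adds a column on the right; shifting and detouring
-- off column 2 adds one on the left, and either way the result is again extendable.  By induction
-- on M, any s ≠ t outside column M are joined by an extendable path: pairs avoiding column 1 or
-- avoiding column M - 1 come from R(M - 1,3), and a pair in columns 1 and M - 1 is joined by a
-- fixed Hamiltonian path of columns 1-2 followed by the induction hypothesis for R(M - 2,3).
-- R(3,3) and R(4,3) are settled by checking explicit routes.

open import Defs
open import Data.Nat using (ℕ; zero; suc; _+_; _∸_; _≤_; _<_; z≤n; s≤s; ∣_-_∣; _≤?_; _/_; _%_)
open import Data.Nat.Properties
  using (_≟_; ≤-refl; ≤-reflexive; ≤-trans; ≤-antisym; ≰⇒>; 1+n≰n; m≤m+n; n≤1+n; +-monoʳ-≤; ∸-monoˡ-≤;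
         m+n∸m≡n; m+[n∸m]≡n; +-cancelˡ-≡; ∣n-n∣≡0; ∣-∣-comm; ∣m+n-m+o∣≡∣n-o∣)
open import Data.Product using (_×_; _,_; Σ; ∃; ∃₂; proj₁; proj₂)
open import Data.Product.Properties using (≡-dec)
open import Data.Sum as Sum using (_⊎_; inj₁; inj₂; [_,_])
open import Data.Maybe as Maybe using (just)
import Data.Maybe.Properties as Maybe
open import Data.Maybe.Relation.Binary.Connected using (Connected; just)
open import Data.List using (List; []; _∷_; _++_; head; last; map; reverse)
open import Data.List.Properties using (head-map; last-map)
open import Data.List.Membership.Propositional using (_∈_; _∉_)
open import Data.List.Membership.Propositional.Properties using (∈-++⁺ˡ; ∈-++⁺ʳ; ∈-++⁻; ∈-map⁺)
open import Data.List.Relation.Unary.Any as Any using (Any; here; there; satisfied; any?)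
import Data.List.Relation.Unary.Any.Properties as Any
open import Data.List.Relation.Unary.All as All using (All; []; _∷_; all?)
import Data.List.Relation.Unary.All.Properties as All
open import Data.List.Relation.Unary.AllPairs using ([]; _∷_)
open import Data.List.Relation.Unary.Unique.Propositional using (Unique)
import Data.List.Relation.Unary.Unique.Propositional.Properties as Unique
open import Data.List.Relation.Unary.Linked as Linked using (Linked; []; [-]; _∷_)
import Data.List.Relation.Unary.Linked.Properties as Linked
open import Function using (_∘_)
open import Relation.Binary.PropositionalEquality using (_≡_; _≢_; refl; sym; trans; cong; cong₂; subst; subst₂)
open import Relation.Nullary using (¬_; Dec; yes; no; ¬?; contradiction)
open import Relation.Nullary.Decidable using (True; toWitness; _×-dec_; _⊎-dec_; map′)
open import Relation.Unary using (Decidable; _⊆_; _≐_; _∪_)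
open import Relation.Unary.Properties using (≐-trans)

private
  variable
    A : Set
    x y v : A
    xs ys Q : List A
    u s t e : Point
    P P₁ P₂ : List Point
    c c′ lo hi lo′ hi′ M : ℕ
    S S₁ S₂ S′ : Point → Set

head-insert : ∀ xs → head (xs ++ x ∷ Q ++ y ∷ ys) ≡ head (xs ++ x ∷ y ∷ ys)
head-insert [] = refl
head-insert (_ ∷ _) = refl

last-++-∷ : ∀ xs → last (xs ++ y ∷ ys) ≡ last (y ∷ ys)
last-++-∷ [] = refl
last-++-∷ (_ ∷ []) = refl
last-++-∷ (_ ∷ _ ∷ xs) = last-++-∷ (_ ∷ xs)

last-insert : ∀ xs → last (xs ++ x ∷ Q ++ y ∷ ys) ≡ last (xs ++ x ∷ y ∷ ys)
last-insert {x = x} {Q = Q} xs =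
  trans (last-++-∷ xs) (trans (last-++-∷ (x ∷ Q)) (sym (last-++-∷ xs)))

∈-insert⁻ : ∀ xs → v ∈ xs ++ x ∷ Q ++ y ∷ ys → v ∈ xs ++ x ∷ y ∷ ys ⊎ v ∈ Q
∈-insert⁻ [] (here p) = inj₁ (here p)
∈-insert⁻ {Q = Q} [] (there p) = [ inj₂ , inj₁ ∘ there ] (∈-++⁻ Q p)
∈-insert⁻ (_ ∷ xs) (here p) = inj₁ (here p)
∈-insert⁻ (_ ∷ xs) (there p) = Sum.map₁ there (∈-insert⁻ xs p)

∈-insert⁺ : ∀ xs → v ∈ xs ++ x ∷ y ∷ ys ⊎ v ∈ Q → v ∈ xs ++ x ∷ Q ++ y ∷ ys
∈-insert⁺ [] (inj₁ (here p)) = here p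
∈-insert⁺ {Q = Q} [] (inj₁ (there p)) = there (∈-++⁺ʳ Q p)
∈-insert⁺ [] (inj₂ q) = there (∈-++⁺ˡ q)
∈-insert⁺ (_ ∷ xs) (inj₁ (here p)) = here p
∈-insert⁺ (_ ∷ xs) (inj₁ (there p)) = there (∈-insert⁺ xs (inj₁ p))
∈-insert⁺ (_ ∷ xs) (inj₂ q) = there (∈-insert⁺ xs (inj₂ q))

Unique-insert : ∀ xs → (∀ {q} → q ∈ Q → q ∉ xs ++ x ∷ y ∷ ys) → Unique Q →
  Unique (xs ++ x ∷ y ∷ ys) → Unique (xs ++ x ∷ Q ++ y ∷ ys)
Unique-insert {Q = Q} [] fresh uQ (x∉ ∷ u) =
  All.tabulate x≢ ∷ Unique.++⁺ uQ u (λ (q , r) → fresh q (there r))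
  where
  x≢ : ∀ {z} → z ∈ Q ++ _ → _ ≢ z
  x≢ p with ∈-++⁻ Q p
  ... | inj₁ q = λ x≡z → fresh q (here (sym x≡z))
  ... | inj₂ r = All.lookup x∉ r
Unique-insert (z ∷ xs) fresh uQ (z∉ ∷ u) =
  All.tabulate z≢ ∷ Unique-insert xs (λ q → fresh q ∘ there) uQ u
  where
  z≢ : ∀ {z′} → z′ ∈ xs ++ _ → z ≢ z′
  z≢ p with ∈-insert⁻ xs p
  ... | inj₁ r = All.lookup z∉ r
  ... | inj₂ q = λ z≡z′ → fresh q (here (sym z≡z′))

Linked-++-∷ : ∀ {R : A → A → Set} xs → Linked R (xs ++ y ∷ []) → Linked R (y ∷ ys) →
  Linked R (xs ++ y ∷ ys)
Linked-++-∷ [] _ l = l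
Linked-++-∷ (_ ∷ []) (r ∷ _) l = r ∷ l
Linked-++-∷ (_ ∷ _ ∷ xs) (r ∷ l′) l = r ∷ Linked-++-∷ (_ ∷ xs) l′ l

Linked-insert : ∀ {R : A → A → Set} xs → Linked R (x ∷ Q ++ y ∷ []) →
  Linked R (xs ++ x ∷ y ∷ ys) → Linked R (xs ++ x ∷ Q ++ y ∷ ys)
Linked-insert {x = x} {Q = Q} [] lQ (_ ∷ l) = Linked-++-∷ (x ∷ Q) lQ l
Linked-insert (_ ∷ []) lQ (r ∷ l) = r ∷ Linked-insert [] lQ l
Linked-insert (_ ∷ _ ∷ xs) lQ (r ∷ l) = r ∷ Linked-insert (_ ∷ xs) lQ l

HasEdge-++⁺ˡ : ∀ ys → HasEdge u v xs → HasEdge u v (xs ++ ys)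
HasEdge-++⁺ˡ _ here-uv = here-uv
HasEdge-++⁺ˡ _ here-vu = here-vu
HasEdge-++⁺ˡ ys (there h) = there (HasEdge-++⁺ˡ ys h)

HasEdge-++⁺ʳ : ∀ xs → HasEdge u v ys → HasEdge u v (xs ++ ys)
HasEdge-++⁺ʳ [] h = h
HasEdge-++⁺ʳ (_ ∷ xs) h = there (HasEdge-++⁺ʳ xs h)

HasEdge-map : ∀ (f : Point → Point) → HasEdge u v xs → HasEdge (f u) (f v) (map f xs)
HasEdge-map f here-uv = here-uv
HasEdge-map f here-vu = here-vu
HasEdge-map f (there h) = there (HasEdge-map f h)

HasEdge-insert : ∀ xs → u ≢ x → u ≢ y →
  HasEdge u v (xs ++ x ∷ y ∷ ys) → HasEdge u v (xs ++ x ∷ Q ++ y ∷ ys)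
HasEdge-insert [] u≢x _ here-uv = contradiction refl u≢x
HasEdge-insert [] _ u≢y here-vu = contradiction refl u≢y
HasEdge-insert {x = x} {Q = Q} [] _ _ (there h) = HasEdge-++⁺ʳ (x ∷ Q) h
HasEdge-insert (_ ∷ []) _ _ here-uv = here-uv
HasEdge-insert (_ ∷ []) _ _ here-vu = here-vu
HasEdge-insert (_ ∷ []) u≢x u≢y (there h) = there (HasEdge-insert [] u≢x u≢y h)
HasEdge-insert (_ ∷ _ ∷ _) _ _ here-uv = here-uv
HasEdge-insert (_ ∷ _ ∷ _) _ _ here-vu = here-vu
HasEdge-insert (_ ∷ _ ∷ xs) u≢x u≢y (there h) = there (HasEdge-insert (_ ∷ xs) u≢x u≢y h)

HasEdge-split : HasEdge u v P →
  ∃₂ λ xs ys → P ≡ xs ++ u ∷ v ∷ ys ⊎ P ≡ xs ++ v ∷ u ∷ ys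
HasEdge-split (here-uv {ys}) = [] , ys , inj₁ refl
HasEdge-split (here-vu {ys}) = [] , ys , inj₂ refl
HasEdge-split {P = z ∷ _} (there h) with HasEdge-split h
... | xs , ys , eq = z ∷ xs , ys , Sum.map (cong (z ∷_)) (cong (z ∷_)) eq

-- Hamiltonian paths on an arbitrary vertex set

record HamPath (S : Point → Set) (s t : Point) (P : List Point) : Set where
  field
    inside   : All S P
    covers   : S ⊆ (_∈ P)
    distinct : Unique P
    adjacent : Linked SAdj P
    startsAt : head P ≡ just s
    endsAt   : last P ≡ just t

HamPath-resp-≐ : S ≐ S′ → HamPath S s t P → HamPath S′ s t P
HamPath-resp-≐ (S⊆S′ , S′⊆S) h = record
  { inside = All.map S⊆S′ inside ; covers = covers ∘ S′⊆S ; distinct = distinct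
  ; adjacent = adjacent ; startsAt = startsAt ; endsAt = endsAt }
  where open HamPath h

HamPath-insert : ∀ xs → (∀ {q} → q ∈ Q → ¬ S q) → Unique Q → Linked SAdj (x ∷ Q ++ y ∷ []) →
  HamPath S s t (xs ++ x ∷ y ∷ ys) → HamPath (S ∪ (_∈ Q)) s t (xs ++ x ∷ Q ++ y ∷ ys)
HamPath-insert xs fresh uQ lQ h = record
  { inside   = All.tabulate (Sum.map₁ (All.lookup inside) ∘ ∈-insert⁻ xs)
  ; covers   = ∈-insert⁺ xs ∘ Sum.map₁ covers
  ; distinct = Unique-insert xs (λ q → fresh q ∘ All.lookup inside) uQ distinct
  ; adjacent = Linked-insert xs lQ adjacent
  ; startsAt = trans (head-insert xs) startsAt
  ; endsAt   = trans (last-insert xs) endsAt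
  }
  where open HamPath h

HamPath-++ : (∀ {v} → S₁ v → ¬ S₂ v) → SAdj e u →
  HamPath S₁ s e P₁ → HamPath S₂ u t P₂ → HamPath (S₁ ∪ S₂) s t (P₁ ++ P₂)
HamPath-++ {P₁ = []} _ _ h₁ _ with () ← HamPath.startsAt h₁
HamPath-++ {P₂ = []} _ _ _ h₂ with () ← HamPath.startsAt h₂
HamPath-++ {e = e} {u = u} {P₁ = p ∷ P₁} {P₂ = q ∷ P₂} disjoint e~u h₁ h₂ = record
  { inside   = All.++⁺ (All.map inj₁ H₁.inside) (All.map inj₂ H₂.inside)
  ; covers   = [ ∈-++⁺ˡ ∘ H₁.covers , ∈-++⁺ʳ (p ∷ P₁) ∘ H₂.covers ]
  ; distinct = Unique.++⁺ H₁.distinct H₂.distinct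
                 (λ (v₁ , v₂) → disjoint (All.lookup H₁.inside v₁) (All.lookup H₂.inside v₂))
  ; adjacent = Linked.++⁺ H₁.adjacent
                 (subst₂ (Connected SAdj) (sym H₁.endsAt) (sym H₂.startsAt) (just e~u))
                 H₂.adjacent
  ; startsAt = H₁.startsAt
  ; endsAt   = trans (last-++-∷ (p ∷ P₁)) H₂.endsAt
  }
  where
  module H₁ = HamPath h₁
  module H₂ = HamPath h₂

HamPath-map : ∀ (f : Point → Point) → (∀ {a b} → f a ≡ f b → a ≡ b) →
  (∀ {a b} → SAdj a b → SAdj (f a) (f b)) → (∀ {v} → S v → S′ (f v)) →
  (∀ {v} → S′ v → ∃ λ w → S w × f w ≡ v) →
  HamPath S s t P → HamPath S′ (f s) (f t) (map f P)
HamPath-map {P = P} f f-inj f-adj f-into f-onto h = record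
  { inside   = All.map⁺ (All.map f-into inside)
  ; covers   = covered ∘ f-onto
  ; distinct = Unique.map⁺ f-inj distinct
  ; adjacent = Linked.map⁺ (Linked.map f-adj adjacent)
  ; startsAt = trans (head-map P) (cong (Maybe.map f) startsAt)
  ; endsAt   = trans (last-map f P) (cong (Maybe.map f) endsAt)
  }
  where
  open HamPath h
  covered : (∃ λ w → _ × f w ≡ v) → v ∈ map f P
  covered (w , Sw , refl) = ∈-map⁺ f (covers Sw)

-- Strips of columns of R(m,3)

Strip : ℕ → ℕ → Point → Set
Strip lo hi (x , y) = (lo ≤ x × x ≤ hi) × (1 ≤ y × y ≤ 3)

Strip-⊆ : lo′ ≤ lo → hi ≤ hi′ → Strip lo hi ⊆ Strip lo′ hi′
Strip-⊆ lo′≤lo hi≤hi′ {_ , _} ((lo≤x , x≤hi) , row) = (≤-trans lo′≤lo lo≤x , ≤-trans x≤hi hi≤hi′) , row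

Strip-split : ∀ mid → Strip lo hi ⊆ Strip lo mid ∪ Strip (suc mid) hi
Strip-split mid {x , _} ((lo≤x , x≤hi) , row) with x ≤? mid
... | yes x≤mid = inj₁ ((lo≤x , x≤mid) , row)
... | no x≰mid = inj₂ ((≰⇒> x≰mid , x≤hi) , row)

Strip-∪ : ∀ {mid} → lo ≤ suc mid → mid ≤ hi → (Strip lo mid ∪ Strip (suc mid) hi) ≐ Strip lo hi
Strip-∪ lo≤ mid≤ = [ Strip-⊆ ≤-refl mid≤ , Strip-⊆ lo≤ ≤-refl ] , Strip-split _

Strip-disjoint : hi < lo′ → Strip lo hi v → ¬ Strip lo′ hi′ v
Strip-disjoint {v = _ , _} hi<lo′ ((_ , x≤hi) , _) ((lo′≤x , _) , _) =
  1+n≰n (≤-trans hi<lo′ (≤-trans lo′≤x x≤hi))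

∪-comm : (S₁ ∪ S₂) ≐ (S₂ ∪ S₁)
∪-comm = Sum.swap , Sum.swap

rows : List ℕ
rows = 1 ∷ 2 ∷ 3 ∷ []

column : ℕ → List Point
column c = map (c ,_) rows

∈-column⁺ : Strip c c v → v ∈ column c
∈-column⁺ {v = _ , 0} (_ , (() , _))
∈-column⁺ {v = _ , 1} ((c≤x , x≤c) , _) = here (cong (_, 1) (≤-antisym x≤c c≤x))
∈-column⁺ {v = _ , 2} ((c≤x , x≤c) , _) = there (here (cong (_, 2) (≤-antisym x≤c c≤x)))
∈-column⁺ {v = _ , 3} ((c≤x , x≤c) , _) = there (there (here (cong (_, 3) (≤-antisym x≤c c≤x))))
∈-column⁺ {v = _ , suc (suc (suc (suc _)))} (_ , (_ , s≤s (s≤s (s≤s ()))))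

∈-column⁻ : v ∈ column c → Strip c c v
∈-column⁻ (here refl) = (≤-refl , ≤-refl) , (s≤s z≤n , s≤s z≤n)
∈-column⁻ (there (here refl)) = (≤-refl , ≤-refl) , (s≤s z≤n , s≤s (s≤s z≤n))
∈-column⁻ (there (there (here refl))) = (≤-refl , ≤-refl) , (s≤s z≤n , ≤-refl)

grid : ℕ → List Point
grid zero = []
grid (suc M) = grid M ++ column (suc M)

∈-grid : ∀ M → Strip 1 M v → v ∈ grid M
∈-grid {_ , _} zero ((1≤x , x≤0) , _) with () ← ≤-trans 1≤x x≤0
∈-grid (suc M) v∈ with Strip-split M v∈
... | inj₁ v∈′ = ∈-++⁺ˡ (∈-grid M v∈′)
... | inj₂ v∈′ = ∈-++⁺ʳ (grid M) (∈-column⁺ v∈′)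

∣m-n∣≡1⇒m≢n : ∀ {m n} → ∣ m - n ∣ ≡ 1 → m ≢ n
∣m-n∣≡1⇒m≢n {m} d refl with () ← trans (sym (∣n-n∣≡0 m)) d

∣n-1+n∣≡1 : ∀ n → ∣ n - suc n ∣ ≡ 1
∣n-1+n∣≡1 zero = refl
∣n-1+n∣≡1 (suc n) = ∣n-1+n∣≡1 n

∣n-n∣≤1 : ∀ n → ∣ n - n ∣ ≤ 1
∣n-n∣≤1 n = ≤-trans (≤-reflexive (∣n-n∣≡0 n)) z≤n

SAdj-horizontal : ∀ {x x′ y y′} → ∣ x - x′ ∣ ≡ 1 → ∣ y - y′ ∣ ≤ 1 → SAdj (x , y) (x′ , y′)
SAdj-horizontal d dy = ∣m-n∣≡1⇒m≢n d ∘ cong proj₁ , ≤-reflexive d , dy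

SAdj-vertical : ∀ {x y y′} → ∣ y - y′ ∣ ≡ 1 → SAdj (x , y) (x , y′)
SAdj-vertical {x} d = ∣m-n∣≡1⇒m≢n d ∘ cong proj₂ , ∣n-n∣≤1 x , ≤-reflexive d

shift : ℕ → Point → Point
shift k (x , y) = k + x , y

shift-injective : ∀ k {u v} → shift k u ≡ shift k v → u ≡ v
shift-injective k {x , y} {x′ , y′} eq =
  cong₂ _,_ (+-cancelˡ-≡ k x x′ (cong proj₁ eq)) (cong proj₂ eq)

SAdj-shift : ∀ k {u v} → SAdj u v → SAdj (shift k u) (shift k v)
SAdj-shift k {x , _} {x′ , _} (u≢v , dx , dy) =
  u≢v ∘ shift-injective k , subst (_≤ 1) (sym (∣m+n-m+o∣≡∣n-o∣ k x x′)) dx , dy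

Strip-shift : ∀ k {v} → Strip lo hi v → Strip (k + lo) (k + hi) (shift k v)
Strip-shift k {_ , _} ((lo≤x , x≤hi) , row) = (+-monoʳ-≤ k lo≤x , +-monoʳ-≤ k x≤hi) , row

Strip-unshift : ∀ {lo hi} k {v} → Strip (k + lo) (k + hi) v → ∃ λ w → Strip lo hi w × shift k w ≡ v
Strip-unshift {lo} {hi} k {x , y} ((lo≤x , x≤hi) , row) =
  (x ∸ k , y) ,
  ((subst (_≤ x ∸ k) (m+n∸m≡n k lo) (∸-monoˡ-≤ k lo≤x) ,
    subst (x ∸ k ≤_) (m+n∸m≡n k hi) (∸-monoˡ-≤ k x≤hi)) , row) ,
  cong (_, y) (m+[n∸m]≡n (≤-trans (m≤m+n k lo) lo≤x))

HamPath-shift : ∀ k → HamPath (Strip lo hi) s t P →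
  HamPath (Strip (k + lo) (k + hi)) (shift k s) (shift k t) (map (shift k) P)
HamPath-shift k = HamPath-map (shift k) (shift-injective k) (SAdj-shift k) (Strip-shift k) (Strip-unshift k)

-- Detouring through a new column

VerticalEdge : ℕ → List Point → Set
VerticalEdge c P = HasEdge (c , 1) (c , 2) P ⊎ HasEdge (c , 2) (c , 3) P

record ColumnDetour (S : Point → Set) (s t : Point) (c c′ : ℕ) (P : List Point) : Set where
  field
    path     : List Point
    isHam    : HamPath (S ∪ Strip c′ c′) s t path
    lower    : HasEdge (c′ , 1) (c′ , 2) path
    upper    : HasEdge (c′ , 2) (c′ , 3) path
    preserve : ∀ {a b} → proj₁ a ≢ c → HasEdge a b P → HasEdge a b path

detourThrough : ∀ xs {x y} Q → proj₁ x ≡ c → proj₁ y ≡ c → (_∈ Q) ≐ Strip c′ c′ → Unique Q →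
  Linked SAdj (x ∷ Q ++ y ∷ []) → HasEdge (c′ , 1) (c′ , 2) Q → HasEdge (c′ , 2) (c′ , 3) Q →
  (∀ {v} → S v → ¬ Strip c′ c′ v) → HamPath S s t (xs ++ x ∷ y ∷ ys) →
  ColumnDetour S s t c c′ (xs ++ x ∷ y ∷ ys)
detourThrough {ys = ys} xs {x} {y} Q refl refl (Q⊆ , ⊆Q) uQ lQ lowerQ upperQ fresh h = record
  { path     = xs ++ x ∷ Q ++ y ∷ ys
  ; isHam    = HamPath-resp-≐ (Sum.map₂ Q⊆ , Sum.map₂ ⊆Q)
                 (HamPath-insert xs (λ q Sq → fresh Sq (Q⊆ q)) uQ lQ h)
  ; lower    = HasEdge-++⁺ʳ xs (there (HasEdge-++⁺ˡ _ lowerQ))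
  ; upper    = HasEdge-++⁺ʳ xs (there (HasEdge-++⁺ˡ _ upperQ))
  ; preserve = λ a∉c → HasEdge-insert xs (a∉c ∘ cong proj₁) (a∉c ∘ cong proj₁)
  }

column-≐ : (_∈ column c) ≐ Strip c c
column-≐ = ∈-column⁻ , ∈-column⁺

reverse-column-≐ : (_∈ reverse (column c)) ≐ Strip c c
reverse-column-≐ = ∈-column⁻ ∘ Any.reverse⁻ , Any.reverse⁺ ∘ ∈-column⁺

Unique-column : Unique (column c)
Unique-column = ((λ ()) ∷ (λ ()) ∷ []) ∷ ((λ ()) ∷ []) ∷ [] ∷ []

Unique-reverse-column : Unique (reverse (column c))
Unique-reverse-column = ((λ ()) ∷ (λ ()) ∷ []) ∷ ((λ ()) ∷ []) ∷ [] ∷ []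

Linked-climb : ∀ {k k′} → ∣ c - c′ ∣ ≡ 1 → ∣ k - 1 ∣ ≤ 1 → ∣ 3 - k′ ∣ ≤ 1 →
  Linked SAdj ((c , k) ∷ column c′ ++ (c , k′) ∷ [])
Linked-climb {c} {c′} d in₁ out₃ =
  SAdj-horizontal d in₁ ∷ SAdj-vertical refl ∷ SAdj-vertical refl ∷
  SAdj-horizontal (trans (∣-∣-comm c′ c) d) out₃ ∷ [-]

Linked-descend : ∀ {k k′} → ∣ c - c′ ∣ ≡ 1 → ∣ k - 3 ∣ ≤ 1 → ∣ 1 - k′ ∣ ≤ 1 →
  Linked SAdj ((c , k) ∷ reverse (column c′) ++ (c , k′) ∷ [])
Linked-descend {c} {c′} d in₃ out₁ =
  SAdj-horizontal d in₃ ∷ SAdj-vertical refl ∷ SAdj-vertical refl ∷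
  SAdj-horizontal (trans (∣-∣-comm c′ c) d) out₁ ∷ [-]

insertColumn : ∣ c - c′ ∣ ≡ 1 → (∀ {v} → S v → ¬ Strip c′ c′ v) →
  HamPath S s t P → VerticalEdge c P → ColumnDetour S s t c c′ P
insertColumn d fresh h (inj₁ e₁₂) with HasEdge-split e₁₂
... | xs , _ , inj₁ refl = detourThrough xs _ refl refl column-≐ Unique-column
                             (Linked-climb d z≤n ≤-refl) here-uv (there here-uv) fresh h
... | xs , _ , inj₂ refl = detourThrough xs _ refl refl reverse-column-≐ Unique-reverse-column
                             (Linked-descend d (s≤s z≤n) z≤n) (there here-vu) here-vu fresh h
insertColumn d fresh h (inj₂ e₂₃) with HasEdge-split e₂₃
... | xs , _ , inj₁ refl = detourThrough xs _ refl refl column-≐ Unique-column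
                             (Linked-climb d (s≤s z≤n) z≤n) here-uv (there here-uv) fresh h
... | xs , _ , inj₂ refl = detourThrough xs _ refl refl reverse-column-≐ Unique-reverse-column
                             (Linked-descend d z≤n (s≤s z≤n)) (there here-vu) here-vu fresh h

record Extendable (M : ℕ) (s t : Point) : Set where
  field
    path      : List Point
    isHam     : HamPath (Strip 1 M) s t path
    lastLower : HasEdge (M , 1) (M , 2) path
    lastUpper : HasEdge (M , 2) (M , 3) path
    firstEdge : VerticalEdge 1 path

extendRight : Extendable (2 + M) s t → Extendable (3 + M) s t
extendRight {M} {s} {t} r = record
  { path      = D.path
  ; isHam     = HamPath-resp-≐ (Strip-∪ (s≤s z≤n) (n≤1+n _)) D.isHam
  ; lastLower = D.lower
  ; lastUpper = D.upper
  ; firstEdge = Sum.map (D.preserve λ ()) (D.preserve λ ()) firstEdge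
  }
  where
  open Extendable r
  D : ColumnDetour (Strip 1 (2 + M)) s t (2 + M) (3 + M) path
  D = insertColumn (∣n-1+n∣≡1 (2 + M)) (Strip-disjoint ≤-refl) isHam (inj₁ lastLower)
  module D = ColumnDetour D

extendLeft : Extendable (2 + M) u v → Extendable (3 + M) (shift 1 u) (shift 1 v)
extendLeft {M} {u} {v} r = record
  { path      = D.path
  ; isHam     = HamPath-resp-≐ (≐-trans ∪-comm (Strip-∪ {mid = 1} (s≤s z≤n) (s≤s z≤n))) D.isHam
  ; lastLower = D.preserve (λ ()) (HasEdge-map (shift 1) lastLower)
  ; lastUpper = D.preserve (λ ()) (HasEdge-map (shift 1) lastUpper)
  ; firstEdge = inj₁ D.lower
  }
  where
  open Extendable r
  D : ColumnDetour (Strip 2 (3 + M)) (shift 1 u) (shift 1 v) 2 1 (map (shift 1) path)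
  D = insertColumn refl (λ v∈ v∈₁ → Strip-disjoint ≤-refl v∈₁ v∈)
        (HamPath-shift 1 isHam) (Sum.map (HasEdge-map (shift 1)) (HasEdge-map (shift 1)) firstEdge)
  module D = ColumnDetour D

prependBlock : ∀ {e} → HamPath (Strip 1 2) s (2 , e) P → VerticalEdge 1 P →
  Extendable M (1 , e) t → Extendable (2 + M) s (shift 2 t)
prependBlock {P = P} {M = M} {e = e} block blockEdge r = record
  { path      = P ++ map (shift 2) path
  ; isHam     = HamPath-resp-≐ (Strip-∪ (s≤s z≤n) (m≤m+n 2 M))
                  (HamPath-++ (Strip-disjoint ≤-refl) (SAdj-horizontal refl (∣n-n∣≤1 e))
                    block (HamPath-shift 2 isHam))
  ; lastLower = HasEdge-++⁺ʳ P (HasEdge-map (shift 2) lastLower)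
  ; lastUpper = HasEdge-++⁺ʳ P (HasEdge-map (shift 2) lastUpper)
  ; firstEdge = Sum.map (HasEdge-++⁺ˡ _) (HasEdge-++⁺ˡ _) blockEdge
  }
  where open Extendable r

appendBlock : ∀ {e} → Extendable M s (1 , e) → HamPath (Strip 1 2) (2 , e) t P → VerticalEdge 1 P →
  Extendable (2 + M) (shift 2 s) t
appendBlock {M = M} {P = P} {e = e} r block blockEdge = record
  { path      = map (shift 2) path ++ P
  ; isHam     = HamPath-resp-≐ (≐-trans ∪-comm (Strip-∪ (s≤s z≤n) (m≤m+n 2 M)))
                  (HamPath-++ (λ v∈ v∈₁ → Strip-disjoint ≤-refl v∈₁ v∈) (SAdj-horizontal refl (∣n-n∣≤1 e))
                    (HamPath-shift 2 isHam) block)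
  ; lastLower = HasEdge-++⁺ˡ P (HasEdge-map (shift 2) lastLower)
  ; lastUpper = HasEdge-++⁺ˡ P (HasEdge-map (shift 2) lastUpper)
  ; firstEdge = Sum.map (HasEdge-++⁺ʳ _) (HasEdge-++⁺ʳ _) blockEdge
  }
  where open Extendable r

-- Small cases, checked by evaluation

_≟ₚ_ : (u v : Point) → Dec (u ≡ v)
_≟ₚ_ = ≡-dec _≟_ _≟_

open import Data.List.Membership.DecPropositional _≟ₚ_ using (_∈?_)
open import Data.List.Relation.Unary.Unique.DecPropositional _≟ₚ_ using (unique?)

strip? : ∀ lo hi → Decidable (Strip lo hi)
strip? lo hi (x , y) = ((lo ≤? x) ×-dec (x ≤? hi)) ×-dec ((1 ≤? y) ×-dec (y ≤? 3))

sAdj? : ∀ u v → Dec (SAdj u v)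
sAdj? (x , y) (x′ , y′) = ¬? ((x , y) ≟ₚ (x′ , y′)) ×-dec ((∣ x - x′ ∣ ≤? 1) ×-dec (∣ y - y′ ∣ ≤? 1))

hasEdge? : ∀ u v P → Dec (HasEdge u v P)
hasEdge? u v [] = no λ ()
hasEdge? u v (a ∷ []) = no λ { (there ()) }
hasEdge? u v (a ∷ b ∷ P) =
  map′ edge unedge (((a ≟ₚ u) ×-dec (b ≟ₚ v)) ⊎-dec (((a ≟ₚ v) ×-dec (b ≟ₚ u)) ⊎-dec hasEdge? u v (b ∷ P)))
  where
  edge : (a ≡ u × b ≡ v) ⊎ (a ≡ v × b ≡ u) ⊎ HasEdge u v (b ∷ P) → HasEdge u v (a ∷ b ∷ P)
  edge (inj₁ (refl , refl)) = here-uv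
  edge (inj₂ (inj₁ (refl , refl))) = here-vu
  edge (inj₂ (inj₂ h)) = there h
  unedge : HasEdge u v (a ∷ b ∷ P) → (a ≡ u × b ≡ v) ⊎ (a ≡ v × b ≡ u) ⊎ HasEdge u v (b ∷ P)
  unedge here-uv = inj₁ (refl , refl)
  unedge here-vu = inj₂ (inj₁ (refl , refl))
  unedge (there h) = inj₂ (inj₂ h)

verticalEdge? : ∀ c P → Dec (VerticalEdge c P)
verticalEdge? c P = hasEdge? (c , 1) (c , 2) P ⊎-dec hasEdge? (c , 2) (c , 3) P

CheckedHamPath : ℕ → Point → Point → List Point → Set
CheckedHamPath M s t P =
  head P ≡ just s × last P ≡ just t × All (Strip 1 M) P × All (_∈ P) (grid M) × Unique P × Linked SAdj P

checkedHamPath? : ∀ M s t P → Dec (CheckedHamPath M s t P)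
checkedHamPath? M s t P =
  Maybe.≡-dec _≟ₚ_ (head P) (just s) ×-dec Maybe.≡-dec _≟ₚ_ (last P) (just t) ×-dec
  all? (strip? 1 M) P ×-dec all? (_∈? P) (grid M) ×-dec unique? P ×-dec Linked.linked? sAdj? P

CheckedHamPath⇒HamPath : CheckedHamPath M s t P → HamPath (Strip 1 M) s t P
CheckedHamPath⇒HamPath {M} (startsAt , endsAt , inside , covers , distinct , adjacent) = record
  { inside = inside ; covers = All.lookup covers ∘ ∈-grid M ; distinct = distinct
  ; adjacent = adjacent ; startsAt = startsAt ; endsAt = endsAt }

ExtendableRoute : ℕ → Point → Point → List Point → Set
ExtendableRoute M s t P =
  CheckedHamPath M s t P × HasEdge (M , 1) (M , 2) P × HasEdge (M , 2) (M , 3) P × VerticalEdge 1 P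

extendableRoute? : ∀ M s t P → Dec (ExtendableRoute M s t P)
extendableRoute? M s t P =
  checkedHamPath? M s t P ×-dec hasEdge? (M , 1) (M , 2) P ×-dec hasEdge? (M , 2) (M , 3) P ×-dec
  verticalEdge? 1 P

ExtendableRoute⇒Extendable : ExtendableRoute M s t P → Extendable M s t
ExtendableRoute⇒Extendable {P = P} (checked , lower , upper , edge) =
  record { path = P ; isHam = CheckedHamPath⇒HamPath checked ; lastLower = lower ; lastUpper = upper
         ; firstEdge = edge }

BlockRoute : Point → Point → List Point → Set
BlockRoute s t P = CheckedHamPath 2 s t P × VerticalEdge 1 P

blockRoute? : ∀ s t P → Dec (BlockRoute s t P)
blockRoute? s t P = checkedHamPath? 2 s t P ×-dec verticalEdge? 1 P

byDecision : ∀ {p} {Pr : A → Set p} (Pr? : Decidable Pr) xs → {True (all? Pr? xs)} → ∀ {x} → x ∈ xs → Pr x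
byDecision Pr? xs {ok} = All.lookup (toWitness ok)

bothWays : List (List Point) → List (List Point)
bothWays routes = routes ++ map reverse routes

-- The digits xy of a cell stand for the vertex (x , y).
route : List ℕ → List Point
route = map λ n → n / 10 , n % 10

tabulated : ∀ M ss ts routes →
  {True (all? (λ s → all? (λ t → (s ≟ₚ t) ⊎-dec any? (extendableRoute? M s t) (bothWays routes)) ts) ss)} →
  s ∈ ss → t ∈ ts → s ≢ t → Extendable M s t
tabulated M ss ts routes {ok} s∈ t∈ s≢t with All.lookup (byDecision _ ss {ok} s∈) t∈
... | inj₁ s≡t = contradiction s≡t s≢t
... | inj₂ found = ExtendableRoute⇒Extendable (proj₂ (satisfied found))

routes₃ : List (List Point)
routes₃ = map route
  ( (11 ∷ 21 ∷ 22 ∷ 31 ∷ 32 ∷ 33 ∷ 23 ∷ 13 ∷ 12 ∷ [])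
  ∷ (11 ∷ 12 ∷ 21 ∷ 22 ∷ 31 ∷ 32 ∷ 33 ∷ 23 ∷ 13 ∷ [])
  ∷ (11 ∷ 12 ∷ 13 ∷ 22 ∷ 23 ∷ 33 ∷ 32 ∷ 31 ∷ 21 ∷ [])
  ∷ (11 ∷ 12 ∷ 13 ∷ 23 ∷ 33 ∷ 32 ∷ 31 ∷ 21 ∷ 22 ∷ [])
  ∷ (11 ∷ 12 ∷ 13 ∷ 22 ∷ 21 ∷ 31 ∷ 32 ∷ 33 ∷ 23 ∷ [])
  ∷ (12 ∷ 11 ∷ 21 ∷ 22 ∷ 31 ∷ 32 ∷ 33 ∷ 23 ∷ 13 ∷ [])
  ∷ (12 ∷ 11 ∷ 22 ∷ 13 ∷ 23 ∷ 33 ∷ 32 ∷ 31 ∷ 21 ∷ [])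
  ∷ (12 ∷ 11 ∷ 21 ∷ 31 ∷ 32 ∷ 33 ∷ 23 ∷ 13 ∷ 22 ∷ [])
  ∷ (12 ∷ 11 ∷ 21 ∷ 31 ∷ 32 ∷ 33 ∷ 22 ∷ 13 ∷ 23 ∷ [])
  ∷ (13 ∷ 12 ∷ 11 ∷ 22 ∷ 23 ∷ 33 ∷ 32 ∷ 31 ∷ 21 ∷ [])
  ∷ (13 ∷ 12 ∷ 11 ∷ 21 ∷ 31 ∷ 32 ∷ 33 ∷ 23 ∷ 22 ∷ [])
  ∷ (13 ∷ 12 ∷ 11 ∷ 21 ∷ 22 ∷ 31 ∷ 32 ∷ 33 ∷ 23 ∷ [])
  ∷ (21 ∷ 11 ∷ 12 ∷ 13 ∷ 23 ∷ 33 ∷ 32 ∷ 31 ∷ 22 ∷ [])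
  ∷ (21 ∷ 11 ∷ 12 ∷ 13 ∷ 22 ∷ 31 ∷ 32 ∷ 33 ∷ 23 ∷ [])
  ∷ (22 ∷ 13 ∷ 12 ∷ 11 ∷ 21 ∷ 31 ∷ 32 ∷ 33 ∷ 23 ∷ [])
  ∷ [])

routes₄ : List (List Point)
routes₄ = map route
  ( (11 ∷ 12 ∷ 13 ∷ 22 ∷ 21 ∷ 32 ∷ 23 ∷ 33 ∷ 43 ∷ 42 ∷ 41 ∷ 31 ∷ [])
  ∷ (11 ∷ 12 ∷ 13 ∷ 22 ∷ 21 ∷ 31 ∷ 41 ∷ 42 ∷ 43 ∷ 33 ∷ 23 ∷ 32 ∷ [])
  ∷ (11 ∷ 12 ∷ 13 ∷ 22 ∷ 21 ∷ 31 ∷ 41 ∷ 42 ∷ 43 ∷ 32 ∷ 23 ∷ 33 ∷ [])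
  ∷ (12 ∷ 11 ∷ 21 ∷ 22 ∷ 13 ∷ 23 ∷ 32 ∷ 33 ∷ 43 ∷ 42 ∷ 41 ∷ 31 ∷ [])
  ∷ (12 ∷ 11 ∷ 21 ∷ 22 ∷ 13 ∷ 23 ∷ 33 ∷ 43 ∷ 42 ∷ 41 ∷ 31 ∷ 32 ∷ [])
  ∷ (12 ∷ 11 ∷ 21 ∷ 22 ∷ 13 ∷ 23 ∷ 32 ∷ 31 ∷ 41 ∷ 42 ∷ 43 ∷ 33 ∷ [])
  ∷ (13 ∷ 12 ∷ 11 ∷ 21 ∷ 22 ∷ 23 ∷ 32 ∷ 33 ∷ 43 ∷ 42 ∷ 41 ∷ 31 ∷ [])
  ∷ (13 ∷ 12 ∷ 11 ∷ 21 ∷ 22 ∷ 23 ∷ 33 ∷ 43 ∷ 42 ∷ 41 ∷ 31 ∷ 32 ∷ [])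
  ∷ (13 ∷ 12 ∷ 11 ∷ 21 ∷ 22 ∷ 23 ∷ 32 ∷ 31 ∷ 41 ∷ 42 ∷ 43 ∷ 33 ∷ [])
  ∷ [])

blockRoutes : List (List Point)
blockRoutes = map route
  ( (11 ∷ 12 ∷ 13 ∷ 23 ∷ 22 ∷ 21 ∷ [])
  ∷ (12 ∷ 13 ∷ 23 ∷ 22 ∷ 11 ∷ 21 ∷ [])
  ∷ (13 ∷ 12 ∷ 11 ∷ 21 ∷ 22 ∷ 23 ∷ [])
  ∷ [])

extendable₃ : Strip 1 2 s → Strip 1 2 t → s ≢ t → Extendable 3 s t
extendable₃ s∈ t∈ = tabulated 3 (grid 2) (grid 2) routes₃ (∈-grid 2 s∈) (∈-grid 2 t∈)

firstToPenultimate₄ : Strip 1 1 s → Strip 3 3 t → Extendable 4 s t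
firstToPenultimate₄ s∈ t∈ = tabulated 4 (column 1) (column 3) routes₄ (∈-column⁺ s∈) (∈-column⁺ t∈)
  (λ { refl → Strip-disjoint (s≤s (s≤s z≤n)) s∈ t∈ })

penultimateToFirst₄ : Strip 3 3 s → Strip 1 1 t → Extendable 4 s t
penultimateToFirst₄ s∈ t∈ = tabulated 4 (column 3) (column 1) routes₄ (∈-column⁺ s∈) (∈-column⁺ t∈)
  (λ { refl → Strip-disjoint (s≤s (s≤s z≤n)) t∈ s∈ })

blockFrom : Strip 1 1 s → ∃ λ e → Strip 1 1 (1 , e) × ∃ (BlockRoute s (2 , e))
blockFrom s∈ =
  let e , e∈ , found = satisfied (byDecision exit? (column 1) (∈-column⁺ s∈)) in e , e∈ , satisfied found
  where
  exit? : ∀ s → Dec (Any (λ e → Strip 1 1 (1 , e) × Any (BlockRoute s (2 , e)) (bothWays blockRoutes)) rows)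
  exit? s = any? (λ e → strip? 1 1 (1 , e) ×-dec any? (blockRoute? s (2 , e)) (bothWays blockRoutes))
                 rows

blockTo : Strip 1 1 t → ∃ λ e → Strip 1 1 (1 , e) × ∃ λ P → BlockRoute (2 , e) t P
blockTo t∈ =
  let e , e∈ , found = satisfied (byDecision entry? (column 1) (∈-column⁺ t∈)) in e , e∈ , satisfied found
  where
  entry? : ∀ t →
    Dec (Any (λ e → Strip 1 1 (1 , e) × Any (λ P → BlockRoute (2 , e) t P) (bothWays blockRoutes)) rows)
  entry? t = any? (λ e → strip? 1 1 (1 , e) ×-dec any? (λ P → blockRoute? (2 , e) t P) (bothWays blockRoutes))
                  rows

AllExtendable : ℕ → Set
AllExtendable n = ∀ {s t} → Strip 1 (2 + n) s → Strip 1 (2 + n) t → s ≢ t → Extendable (3 + n) s t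

FirstToPenultimate PenultimateToFirst : ℕ → Set
FirstToPenultimate n = ∀ {s t} → Strip 1 1 s → Strip (3 + n) (3 + n) t → Extendable (4 + n) s t
PenultimateToFirst n = ∀ {s t} → Strip (3 + n) (3 + n) s → Strip 1 1 t → Extendable (4 + n) s t

firstToPenultimate : ∀ {n} → AllExtendable n → FirstToPenultimate (suc n)
firstToPenultimate ih s∈ t∈ with blockFrom s∈ | Strip-unshift 2 t∈
... | e , e∈ , _ , checked , edge | w , w∈ , refl =
  prependBlock (CheckedHamPath⇒HamPath checked) edge
    (ih (Strip-⊆ ≤-refl (s≤s z≤n) e∈) (Strip-⊆ (s≤s z≤n) ≤-refl w∈)
        (λ { refl → Strip-disjoint (s≤s (s≤s z≤n)) e∈ w∈ }))

penultimateToFirst : ∀ {n} → AllExtendable n → PenultimateToFirst (suc n)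
penultimateToFirst ih s∈ t∈ with Strip-unshift 2 s∈ | blockTo t∈
... | w , w∈ , refl | e , e∈ , _ , checked , edge =
  appendBlock
    (ih (Strip-⊆ (s≤s z≤n) ≤-refl w∈) (Strip-⊆ ≤-refl (s≤s z≤n) e∈)
        (λ { refl → Strip-disjoint (s≤s (s≤s z≤n)) e∈ w∈ }))
    (CheckedHamPath⇒HamPath checked) edge

extendableStep : ∀ {n} → FirstToPenultimate n → PenultimateToFirst n →
  AllExtendable n → AllExtendable (suc n)
extendableStep {n} corner corner′ ih {s} {t} s∈ t∈ s≢t = byColumns (Strip-split 1 s∈) (Strip-split 1 t∈)
  where
  byColumns : (Strip 1 1 ∪ Strip 2 (3 + n)) s → (Strip 1 1 ∪ Strip 2 (3 + n)) t → Extendable (4 + n) s t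
  byColumns (inj₂ s≥2) (inj₂ t≥2) with Strip-unshift 1 s≥2 | Strip-unshift 1 t≥2
  ... | _ , s₀∈ , refl | _ , t₀∈ , refl = extendLeft (ih s₀∈ t₀∈ (s≢t ∘ cong (shift 1)))
  byColumns (inj₁ s₁) _ with Strip-split (2 + n) t∈
  ... | inj₁ t′ = extendRight (ih (Strip-⊆ ≤-refl (s≤s z≤n) s₁) t′ s≢t)
  ... | inj₂ tₚ = corner s₁ tₚ
  byColumns (inj₂ _) (inj₁ t₁) with Strip-split (2 + n) s∈
  ... | inj₁ s′ = extendRight (ih s′ (Strip-⊆ ≤-refl (s≤s z≤n) t₁) s≢t)
  ... | inj₂ sₚ = corner′ sₚ t₁

extendable : ∀ n → AllExtendable n
extendable zero = extendable₃
extendable (suc zero) = extendableStep firstToPenultimate₄ penultimateToFirst₄ extendable₃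
extendable (suc (suc n)) =
  extendableStep (firstToPenultimate (extendable n)) (penultimateToFirst (extendable n)) (extendable (suc n))

notInLastColumn : ∀ {M v} → InRect (suc M) 3 v →
  v ≢ (suc M , 1) → v ≢ (suc M , 2) → v ≢ (suc M , 3) → Strip 1 M v
notInLastColumn {M} {_ , _} v∈ v≢₁ v≢₂ v≢₃ with Strip-split M v∈
... | inj₁ v∈′ = v∈′
... | inj₂ vₗ with ∈-column⁺ vₗ
...   | here eq = contradiction eq v≢₁
...   | there (here eq) = contradiction eq v≢₂
...   | there (there (here eq)) = contradiction eq v≢₃

HamPath⇒IsHamPath : HamPath (Strip 1 M) s t P → IsHamPath M 3 s t P
HamPath⇒IsHamPath h = record
  { inside = All.map (λ { {_ , _} v∈ → v∈ }) inside ; covers = λ { (_ , _) v∈ → covers v∈ }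
  ; distinct = distinct ; adjacent = adjacent ; startsAt = startsAt ; endsAt = endsAt }
  where open HamPath h

lemma6 : (m : ℕ) → 3 ≤ m → (s t : Point) →
    InRect m 3 s → InRect m 3 t → ¬ (s ≡ t) →
    ¬ (s ≡ (m , 1)) → ¬ (s ≡ (m , 2)) → ¬ (s ≡ (m , 3)) →
    ¬ (t ≡ (m , 1)) → ¬ (t ≡ (m , 2)) → ¬ (t ≡ (m , 3)) →
    Σ (List Point) (λ P → IsHamPath m 3 s t P ×
      (HasEdge (m , 1) (m , 2) P × HasEdge (m , 2) (m , 3) P))
lemma6 (suc (suc (suc n))) (s≤s (s≤s (s≤s _))) s t s∈ t∈ s≢t s≢₁ s≢₂ s≢₃ t≢₁ t≢₂ t≢₃ =
  path , HamPath⇒IsHamPath isHam , lastLower , lastUpper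
  where
  open Extendable
    (extendable n (notInLastColumn s∈ s≢₁ s≢₂ s≢₃) (notInLastColumn t∈ t≢₁ t≢₂ t≢₃) s≢t)
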